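{- Let $\Gamma$ be a context, $\Delta$ a typing and $R$ a (user-defined or run-time) process with $\Gamma \Vdash R \rhd \Delta$. Then $R$ is not an error.
   Context: TYPES. Ground types $G$ are, e.g., $\mathtt{Nat}, \mathtt{Bool}$. Labels range over a countable set $\mathcal L$, channel names over a countable set $\mathcal K$, and polarities $p\in\{+,-\}$ with $\overline{+}=-$ and $\overline{ - }=+$. Session types are $$S ::= \mathsf{end} \mid ?G.S \mid !G.S \mid ?(S_1^p).S_2 \mid !(S_1^p).S_2 \mid \oplus\{l_i{:}S_i\}_{i\in I} \mid \&\{l_i{:}S_i\}_{i\in I} \mid \langle\!\langle l_i{:}S_i\rangle\!\rangle_{i\in I},$$ read as: terminated, value input/output, session input/output, selection, branching, speculative selection. $I$ is finite and nonempty and labels are pairwise distinct. ORCHESTRATORS. $\mathsf f,\mathsf g ::= \mathfrak 1 \mid \bullet.\mathsf f \mid l.\mathsf f \mid l.\mathsf f+l'.\mathsf g \mid l.\mathsf f\oplus l'.\mathsf g$ with $l\ne l'$. We write $\sum_{i\in I}l_i.\mathsf f_i$ and $\bigoplus_{i\in I}l_i.\mathsf f_i$ for $n$-ary choices; a singleton index set gives the prefix. COMPLIANCE. $\mathsf f:S\dashv S'$ is the least relation such that: (1) $\mathfrak 1:\mathsf{end}\dashv S$ for every $S$; (2) if $\mathsf f:S\dashv S'$ then $\bullet.\mathsf f: ?G.S\dashv !G.S'$ and $\bullet.\mathsf f:!G.S\dashv ?G.S'$; (2') if $\mathsf f:S_2\dashv S_2'$ then $\bullet.\mathsf f:?(S_1^p).S_2\dashv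 !(S_1^p).S_2'$ and $\bullet.\mathsf f:!(S_1^p).S_2\dashv ?(S_1^p).S_2'$; (3) if $\mathsf f_i:S_i\dashv S_i'$ for all $i\in I$, then for any $J$: $\sum_{i\in I}l_i.\mathsf f_i:\oplus\{l_i{:}S_i\}_{i\in I}\dashv\&\{l_j{:}S'_j\}_{j\in I\cup J}$ and $\sum_{i\in I}l_i.\mathsf f_i:\&\{l_j{:}S_j\}_{j\in I\cup J}\dashv\oplus\{l_i{:}S'_i\}_{i\in I}$; (4) if $\emptyset\ne H\subseteq I\cap J$ and $\mathsf f_h:S_h\dashv S_h'$ for $h\in H$, then $\bigoplus_{h\in H}l_h.\mathsf f_h:\langle\!\langle l_i{:}S_i\rangle\!\rangle_{i\in I}\dashv\&\{l_j{:}S'_j\}_{j\in J}$ and $\bigoplus_{h\in H}l_h.\mathsf f_h:\&\{l_j{:}S_j\}_{j\in J}\dashv\langle\!\langle l_i{:}S'_i\rangle\!\rangle_{i\in I}$. PROCESSES. User-defined processes are closed terms of $$P ::= \mathbf 0 \mid P\mid Q \mid \mathtt{request}(a{:}S)(k).P \mid \mathtt{accept}(a{:}S)(k).P \mid k!\langle e\rangle.P \mid k?(x).P \mid \mathtt{throw}\,k\langle k'\rangle.P \mid \mathtt{catch}\,k(k').P \mid k\triangleleft l.P \mid k\triangleright\{l_i{:}P_i\}_{i\in I} \mid k\triangleleft\langle\!\langle l_i{:}P_i\rangle\!\rangle_{i\in I}.$$ Here $a$ is an uninterpreted name, $e$ an expression, and $k\triangleleft\langle\!\langle\cdot\rangle\!\rangle$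 is speculative selection. Run-time processes are $$R ::= (\nu k)(k[\mathsf f]\mid P) \mid (\nu k)(k[\mathsf f]\mid R)\mid P\mid R\mid R\mid P\mid R\mid R',$$ where $k[\mathsf f]$ is the orchestrator $\mathsf f$ named by $k$. Channels may be polarized as $k^p$, and $(\nu k)$ binds $k$, $k^+$, $k^-$. TYPING. Contexts $\Gamma$ map variables to ground types; $\Gamma\vdash e:G$ types expressions. Typings $\Delta$ are finite maps from polarized channels to session types, and $\Delta\cdot\Delta'$ is their union, defined only when the domains are disjoint. The judgement $\Gamma\Vdash P\rhd\Delta$ is defined by the rules: - $\Gamma\Vdash\mathbf 0\rhd\Delta$ if every type in $\Delta$ is $\mathsf{end}$; - from $\Gamma\Vdash P\rhd\Delta$ and $\Gamma\Vdash Q\rhd\Delta'$ infer $\Gamma\Vdash P\mid Q\rhd\Delta\cdot\Delta'$; - from $\Gamma\Vdash P\{k^+/k\}\rhd\Delta\cdot k^+{:}S$ infer $\Gamma\Vdash\mathtt{accept}(a{:}S)(k).P\rhd\Delta$; similarly with $k^-$ for $\mathtt{request}$; - from $\Gamma,x{:}G\Vdash P\rhd\Delta\cdot k^p{:}S$ infer $\Gamma\Vdash k^p?(x).P\rhd\Delta\cdot k^p{:}?G.S$; - from $\Gamma\vdash e:G$ and $\Gamma\Vdash P\rhd\Delta\cdot k^p{:}S$ infer $\Gamma\Vdash k^p!\langle e\rangle.P\rhd\Delta\cdot k^p{:}!G.S$; - from $\Gamma\Vdash P\{k'^q/k'\}\rhd\Delta\cdot k^p{:}S_2\cdot k'^q{:}S_1$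 infer $\Gamma\Vdash\mathtt{catch}\,k^p(k').P\rhd\Delta\cdot k^p{:}?(S_1^q).S_2$; - from $\Gamma\Vdash P\rhd\Delta\cdot k^p{:}S_2$ infer $\Gamma\Vdash\mathtt{throw}\,k^p\langle k'^q\rangle.P\rhd\Delta\cdot k^p{:}!(S_1^q).S_2\cdot k'^q{:}S_1$; - if $J\subseteq I$ and $\Gamma\Vdash P_i\rhd\Delta\cdot k^p{:}S_i$ for all $i\in I$, infer $\Gamma\Vdash k^p\triangleright\{l_i{:}P_i\}_{i\in I}\rhd\Delta\cdot k^p{:}\&\{l_j{:}S_j\}_{j\in J}$; - if $j\in I$ and $\Gamma\Vdash P\rhd\Delta\cdot k^p{:}S_j$, infer $\Gamma\Vdash k^p\triangleleft l_j.P\rhd\Delta\cdot k^p{:}\oplus\{l_i{:}S_i\}_{i\in I}$; - if $\Gamma\Vdash P_i\rhd\Delta\cdot k^p{:}S_i$ for all $i\in I$, infer $\Gamma\Vdash k^p\triangleleft\langle\!\langle l_i{:}P_i\rangle\!\rangle_{i\in I}\rhd\Delta\cdot k^p{:}\langle\!\langle l_i{:}S_i\rangle\!\rangle_{i\in I}$; - from $\Gamma\Vdash P\rhd\Delta\cdot k^-{:}S_1\cdot k^+{:}S_2$ and $\mathsf f:S_1\dashv S_2$ infer $\Gamma\Vdash(\nu k)(k[\mathsf f]\mid P)\rhd\Delta$; - from $\Gamma\Vdash P\rhd\Delta$ with $k^+,k^-\notin\mathrm{dom}(\Delta)$ infer $\Gamma\Vdash(\nu k)P\rhd\Delta$. REDUCTION.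 Structural congruence $\equiv$ is the least congruence containing: - $\alpha$-renaming of bound channels; - $(\nu k)(k[\mathsf f]\mid Q\mid(\nu k')(k'[\mathsf g]\mid Q'\mid R))\equiv(\nu k')(k'[\mathsf g]\mid(\nu k)(k[\mathsf f]\mid Q\mid Q')\mid R)$, provided $k\notin fc(R)$ and $k'\notin fc(Q)$; - commutativity and associativity of $\mid$ among terms that are not named orchestrators. Reduction $\to$ is defined by the following axioms: - $\mathtt{request}(a{:}S)(k).P\mid\mathtt{accept}(b{:}S')(k).Q\to(\nu k)(k[\mathsf f]\mid P\{k^-/k\}\mid Q\{k^+/k\})$ if $\mathsf f:S\dashv S'$; - $(\nu k)(k[\bullet.\mathsf f]\mid k^p!\langle e\rangle.P\mid k^{\overline p}?(x).Q)\to(\nu k)(k[\mathsf f]\mid P\mid Q\{v/x\})$ if $e$ evaluates to $v$; - $(\nu k)(k[\bullet.\mathsf f]\mid\mathtt{throw}\,k^p\langle k'^q\rangle.P\mid\mathtt{catch}\,k^{\overline p}(k').Q)\to(\nu k)(k[\mathsf f]\mid P\mid Q\{k'^q/k'\})$; - $(\nu k)(k[\sum_{h\in H}l_h.\mathsf f_h]\mid k^p\triangleleft l_c.P\mid k^{\overline p}\triangleright\{l_i{:}Q_i\}_{i\in I})\to(\nu k)(k[\mathsf f_c]\mid P\mid Q_c)$ if $c\in H\cap I$; - $(\nu k)(k[\bigoplus_{h\in H}l_h.\mathsf f_h]\mid k^p\triangleleft\langle\!\langle l_j{:}P_j\rangle\!\rangle_{j\in J}\mid k^{\overline p}\triangleright\{l_i{:}Q_i\}_{i\in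 I})\to(\nu k)(k[\mathsf f_c]\mid P_c\mid Q_c)$ if $c\in H\cap I\cap J$. It is closed under parallel composition ($P\to P'$ implies $P\mid Q\to P'\mid Q$), restriction ($P\to P'$ implies $(\nu k)P\to(\nu k)P'$), and $\equiv$. ERRORS. A $k^p$-process is one of: $k^p!\langle e\rangle.P$, $k^p?(x).P$, $\mathtt{throw}\,k^p\langle k'^q\rangle.P$, $\mathtt{catch}\,k^p(k'^q).P$, $k^p\triangleleft l.P$, $k^p\triangleright\{l_i{:}P_i\}_{i\in I}$, $k^p\triangleleft\langle\!\langle l_i{:}P_i\rangle\!\rangle_{i\in I}$. A potential $k$-redex is a parallel composition of one $k^p$-process, one $k^q$-process (for some $p,q$) and one orchestrator named $k$. A process is an orchestrated synchronization error if it contains a potential $k$-redex that does not reduce. It is a vacuous-orchestration error if it contains a subterm $k[\mathfrak 1]\mid R''$ with $R''$ a $k^-$-process. An error is either of these. -}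

module Defs where

open import Data.Nat using (ℕ; zero; suc; _≡ᵇ_)
open import Data.Bool using (Bool; true; false; if_then_else_)
open import Data.Fin using (Fin)
open import Data.List using (List; []; _∷_; map; _++_)
open import Data.List.Membership.Propositional using (_∈_)
open import Data.List.Relation.Unary.All using (All)
open import Data.List.Relation.Unary.Unique.Propositional using (Unique)
open import Data.List.Relation.Binary.Permutation.Propositional using (_↭_)
open import Data.Maybe using (Maybe; just; nothing)
open import Data.Product using (Σ; ∃; _×_; _,_; proj₁; proj₂)
open import Data.Sum using (_⊎_)
open import Relation.Binary.PropositionalEquality using (_≡_; _≢_)
open import Relation.Nullary using (¬_)

Label : Set
Label = ℕ

ChName : Set
ChName = ℕ

Var : Set
Var = ℕ

Name : Set
Name = ℕ

data Pol : Set where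
  ⁺ ⁻ : Pol

dual : Pol → Pol
dual ⁺ = ⁻
dual ⁻ = ⁺

data Chan : Set where
  raw : ChName → Chan
  pol : ChName → Pol → Chan

-- Labelled families {l_i : x_i}_{i ∈ I}: I finite and nonempty
-- (I = Fin (suc size)), labels pairwise distinct (lab injective).

record Family (A : Set) : Set where
  constructor fam
  field
    size    : ℕ
    lab     : Fin (suc size) → Label
    lab-inj : ∀ i j → lab i ≡ lab j → i ≡ j
    cont    : Fin (suc size) → A
open Family public

Idx : ∀ {A : Set} → Family A → Set
Idx F = Fin (suc (size F))

_∈L_ : ∀ {A : Set} → Label → Family A → Set
l ∈L F = Σ (Idx F) λ i → lab F i ≡ l

data Ground : Set where
  Nat Bool′ : Ground

data Value : Set where
  natV  : ℕ → Value
  boolV : Bool → Value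

data Expr : Set where
  var : Var → Expr
  val : Value → Expr

eval : Expr → Maybe Value
eval (var x) = nothing
eval (val v) = just v

data SType : Set where
  end    : SType
  ?G_∙_  : Ground → SType → SType
  !G_∙_  : Ground → SType → SType
  ?S     : SType → Pol → SType → SType
  !S     : SType → Pol → SType → SType
  ⊕T     : Family SType → SType
  &T     : Family SType → SType
  ⟪_⟫T   : Family SType → SType

-- Orchestrators.  l.f is the singleton choice (both Σ and ⊕ with a
-- singleton index set denote the prefix l.f).

data Orch : Set where
  𝟙    : Orch
  •_   : Orch → Orch
  Σo   : Family Orch → Orch
  ⊕o   : Family Orch → Orch

data SumOf : Orch → Family Orch → Set where
  sum   : ∀ {F} → SumOf (Σo F) F
  sing  : ∀ {F} → size F ≡ 0 → SumOf (⊕o F) F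

data OplusOf : Orch → Family Orch → Set where
  oplus : ∀ {F} → OplusOf (⊕o F) F
  sing  : ∀ {F} → size F ≡ 0 → OplusOf (Σo F) F

infix 4 _∶_⊣_
data _∶_⊣_ : Orch → SType → SType → Set where
  c-end  : ∀ {S} → 𝟙 ∶ end ⊣ S
  c-in   : ∀ {f G S S'} → f ∶ S ⊣ S' → • f ∶ ?G G ∙ S ⊣ !G G ∙ S'
  c-out  : ∀ {f G S S'} → f ∶ S ⊣ S' → • f ∶ !G G ∙ S ⊣ ?G G ∙ S'
  c-sin  : ∀ {f S₁ p S₂ S₂'} → f ∶ S₂ ⊣ S₂' → • f ∶ ?S S₁ p S₂ ⊣ !S S₁ p S₂'
  c-sout : ∀ {f S₁ p S₂ S₂'} → f ∶ S₂ ⊣ S₂' → • f ∶ !S S₁ p S₂ ⊣ ?S S₁ p S₂'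
  c-sel  : ∀ {f} {O : Family Orch} {A B : Family SType}
         → SumOf f O
         → (∀ l → l ∈L O → l ∈L A) → (∀ l → l ∈L A → l ∈L O)
         → (∀ l → l ∈L A → l ∈L B)
         → (∀ i j k → lab O i ≡ lab A j → lab A j ≡ lab B k
                    → cont O i ∶ cont A j ⊣ cont B k)
         → f ∶ ⊕T A ⊣ &T B
  c-bra  : ∀ {f} {O : Family Orch} {A B : Family SType}
         → SumOf f O
         → (∀ l → l ∈L O → l ∈L B) → (∀ l → l ∈L B → l ∈L O)
         → (∀ l → l ∈L B → l ∈L A)
         → (∀ i j k → lab O i ≡ lab A j → lab A j ≡ lab B k
                    → cont O i ∶ cont A j ⊣ cont B k)
         → f ∶ &T A ⊣ ⊕T B
  -- (4), first half: ⊕_{h∈H} l_h.f_h : ⟨⟨l_i:S_i⟩⟩_{i∈I} ⊣ &{l_j:S'_j}_{j∈J},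
  --      ∅ ≠ H ⊆ I ∩ J   (H nonempty since families are nonempty)
  c-spec : ∀ {f} {O : Family Orch} {A B : Family SType}
         → OplusOf f O
         → (∀ l → l ∈L O → l ∈L A) → (∀ l → l ∈L O → l ∈L B)
         → (∀ i j k → lab O i ≡ lab A j → lab A j ≡ lab B k
                    → cont O i ∶ cont A j ⊣ cont B k)
         → f ∶ ⟪ A ⟫T ⊣ &T B
  c-spec' : ∀ {f} {O : Family Orch} {A B : Family SType}
         → OplusOf f O
         → (∀ l → l ∈L O → l ∈L A) → (∀ l → l ∈L O → l ∈L B)
         → (∀ i j k → lab O i ≡ lab A j → lab A j ≡ lab B k
                    → cont O i ∶ cont A j ⊣ cont B k)
         → f ∶ &T A ⊣ ⟪ B ⟫T

-- Processes (user-defined and run-time share one syntax; the grammar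
-- restriction is imposed by the predicate  Good  below).
--   orch k f P  is  (νk)(k[f] | P)

data Proc : Set where
  𝟎       : Proc
  _∥_     : Proc → Proc → Proc
  request : Name → SType → ChName → Proc → Proc
  accept  : Name → SType → ChName → Proc → Proc
  send    : Chan → Expr → Proc → Proc
  recv    : Chan → Var → Proc → Proc
  throw   : Chan → Chan → Proc → Proc
  catch   : Chan → ChName → Proc → Proc
  select  : Chan → Label → Proc → Proc
  branch  : Chan → Family Proc → Proc
  specsel : Chan → Family Proc → Proc
  orch    : ChName → Orch → Proc → Proc

data User : Proc → Set where
  u-nil     : User 𝟎
  u-par     : ∀ {P Q} → User P → User Q → User (P ∥ Q)
  u-request : ∀ {a S k P} → User P → User (request a S k P)
  u-accept  : ∀ {a S k P} → User P → User (accept a S k P)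
  u-send    : ∀ {c e P} → User P → User (send c e P)
  u-recv    : ∀ {c x P} → User P → User (recv c x P)
  u-throw   : ∀ {c c' P} → User P → User (throw c c' P)
  u-catch   : ∀ {c k P} → User P → User (catch c k P)
  u-select  : ∀ {c l P} → User P → User (select c l P)
  u-branch  : ∀ {c F} → (∀ i → User (cont F i)) → User (branch c F)
  u-specsel : ∀ {c F} → (∀ i → User (cont F i)) → User (specsel c F)

data Good : Proc → Set where
  g-user : ∀ {P} → User P → Good P
  g-orch : ∀ {k f P} → Good P → Good (orch k f P)
  g-par  : ∀ {P Q} → Good P → Good Q → Good (P ∥ Q)

data ClosedE (bs : List Var) : Expr → Set where
  ce-var : ∀ {x} → x ∈ bs → ClosedE bs (var x)
  ce-val : ∀ {v} → ClosedE bs (val v)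

data ClosedIn (bs : List Var) : Proc → Set where
  cl-nil     : ClosedIn bs 𝟎
  cl-par     : ∀ {P Q} → ClosedIn bs P → ClosedIn bs Q → ClosedIn bs (P ∥ Q)
  cl-request : ∀ {a S k P} → ClosedIn bs P → ClosedIn bs (request a S k P)
  cl-accept  : ∀ {a S k P} → ClosedIn bs P → ClosedIn bs (accept a S k P)
  cl-send    : ∀ {c e P} → ClosedE bs e → ClosedIn bs P → ClosedIn bs (send c e P)
  cl-recv    : ∀ {c x P} → ClosedIn (x ∷ bs) P → ClosedIn bs (recv c x P)
  cl-throw   : ∀ {c c' P} → ClosedIn bs P → ClosedIn bs (throw c c' P)
  cl-catch   : ∀ {c k P} → ClosedIn bs P → ClosedIn bs (catch c k P)
  cl-select  : ∀ {c l P} → ClosedIn bs P → ClosedIn bs (select c l P)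
  cl-branch  : ∀ {c F} → (∀ i → ClosedIn bs (cont F i)) → ClosedIn bs (branch c F)
  cl-specsel : ∀ {c F} → (∀ i → ClosedIn bs (cont F i)) → ClosedIn bs (specsel c F)
  cl-orch    : ∀ {k f P} → ClosedIn bs P → ClosedIn bs (orch k f P)

Closed : Proc → Set
Closed = ClosedIn []

subC : ChName → Chan → Chan → Chan
subC k c (raw k') = if k ≡ᵇ k' then c else raw k'
subC k c (pol k' p) = pol k' p

_[_/_] : Proc → Chan → ChName → Proc
𝟎 [ c / k ] = 𝟎
(P ∥ Q) [ c / k ] = (P [ c / k ]) ∥ (Q [ c / k ])
request a S k' P [ c / k ] = request a S k' (if k ≡ᵇ k' then P else P [ c / k ])
accept a S k' P [ c / k ] = accept a S k' (if k ≡ᵇ k' then P else P [ c / k ])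
send d e P [ c / k ] = send (subC k c d) e (P [ c / k ])
recv d x P [ c / k ] = recv (subC k c d) x (P [ c / k ])
throw d d' P [ c / k ] = throw (subC k c d) (subC k c d') (P [ c / k ])
catch d k' P [ c / k ] = catch (subC k c d) k' (if k ≡ᵇ k' then P else P [ c / k ])
select d l P [ c / k ] = select (subC k c d) l (P [ c / k ])
branch d (fam n l inj g) [ c / k ] = branch (subC k c d) (fam n l inj (λ i → g i [ c / k ]))
specsel d (fam n l inj g) [ c / k ] = specsel (subC k c d) (fam n l inj (λ i → g i [ c / k ]))
orch k' f P [ c / k ] = orch k' f (if k ≡ᵇ k' then P else P [ c / k ])

Ctx : Set
Ctx = List (Var × Ground)

lookupCtx : Ctx → Var → Maybe Ground
lookupCtx [] x = nothing
lookupCtx ((y , G) ∷ Γ) x = if x ≡ᵇ y then just G else lookupCtx Γ x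

data ValTy : Value → Ground → Set where
  vt-nat  : ∀ {n} → ValTy (natV n) Nat
  vt-bool : ∀ {b} → ValTy (boolV b) Bool′

infix 4 _⊢_∶_
data _⊢_∶_ (Γ : Ctx) : Expr → Ground → Set where
  t-var : ∀ {x G} → lookupCtx Γ x ≡ just G → Γ ⊢ var x ∶ G
  t-val : ∀ {v G} → ValTy v G → Γ ⊢ val v ∶ G

-- Typings Δ: finite maps from polarised channels to session types,
-- represented by lists with pairwise distinct keys, taken up to
-- permutation.  "Δ' is Δ · k^p:S" is written  Δ' ↭ (k^p , S) ∷ Δ  with
-- Δ' having distinct keys (this also enforces disjointness).

PChan : Set
PChan = ChName × Pol

Typing : Set
Typing = List (PChan × SType)

IsTyping : Typing → Set
IsTyping Δ = Unique (map proj₁ Δ)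

IsEnd : PChan × SType → Set
IsEnd (_ , S) = S ≡ end

infix 3 _⊩_▷_
data _⊩_▷_ (Γ : Ctx) : Proc → Typing → Set where
  t-nil : ∀ {Δ} → IsTyping Δ → All IsEnd Δ → Γ ⊩ 𝟎 ▷ Δ
  t-par : ∀ {P Q Δ Δ₁ Δ₂}
        → Γ ⊩ P ▷ Δ₁ → Γ ⊩ Q ▷ Δ₂
        → IsTyping Δ → Δ ↭ (Δ₁ ++ Δ₂)
        → Γ ⊩ P ∥ Q ▷ Δ
  t-accept : ∀ {a S k P Δ}
        → Γ ⊩ P [ pol k ⁺ / k ] ▷ ((k , ⁺) , S) ∷ Δ
        → Γ ⊩ accept a S k P ▷ Δ
  t-request : ∀ {a S k P Δ}
        → Γ ⊩ P [ pol k ⁻ / k ] ▷ ((k , ⁻) , S) ∷ Δ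
        → Γ ⊩ request a S k P ▷ Δ
  t-recv : ∀ {k p x G S P Δ Δ'}
        → (x , G) ∷ Γ ⊩ P ▷ ((k , p) , S) ∷ Δ
        → IsTyping Δ' → Δ' ↭ ((k , p) , ?G G ∙ S) ∷ Δ
        → Γ ⊩ recv (pol k p) x P ▷ Δ'
  t-send : ∀ {k p e G S P Δ Δ'}
        → Γ ⊢ e ∶ G
        → Γ ⊩ P ▷ ((k , p) , S) ∷ Δ
        → IsTyping Δ' → Δ' ↭ ((k , p) , !G G ∙ S) ∷ Δ
        → Γ ⊩ send (pol k p) e P ▷ Δ'
  t-catch : ∀ {k p k' q S₁ S₂ P Δ Δ'}
        → Γ ⊩ P [ pol k' q / k' ] ▷ ((k , p) , S₂) ∷ ((k' , q) , S₁) ∷ Δ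
        → IsTyping Δ' → Δ' ↭ ((k , p) , ?S S₁ q S₂) ∷ Δ
        → Γ ⊩ catch (pol k p) k' P ▷ Δ'
  t-throw : ∀ {k p k' q S₁ S₂ P Δ Δ'}
        → Γ ⊩ P ▷ ((k , p) , S₂) ∷ Δ
        → IsTyping Δ' → Δ' ↭ ((k , p) , !S S₁ q S₂) ∷ ((k' , q) , S₁) ∷ Δ
        → Γ ⊩ throw (pol k p) (pol k' q) P ▷ Δ'
  t-branch : ∀ {k p} {Ps : Family Proc} {T : Family SType} {Δ Δ'}
        → (Ss : Idx Ps → SType)
        → (∀ i → Γ ⊩ cont Ps i ▷ ((k , p) , Ss i) ∷ Δ)
        → (∀ j → Σ (Idx Ps) λ i → lab Ps i ≡ lab T j × Ss i ≡ cont T j)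
        → IsTyping Δ' → Δ' ↭ ((k , p) , &T T) ∷ Δ
        → Γ ⊩ branch (pol k p) Ps ▷ Δ'
  t-select : ∀ {k p} {T : Family SType} {P Δ Δ'} (j : Idx T)
        → Γ ⊩ P ▷ ((k , p) , cont T j) ∷ Δ
        → IsTyping Δ' → Δ' ↭ ((k , p) , ⊕T T) ∷ Δ
        → Γ ⊩ select (pol k p) (lab T j) P ▷ Δ'
  t-spec : ∀ {k p} {Ps : Family Proc} {T : Family SType} {Δ Δ'}
        → (∀ l → l ∈L Ps → l ∈L T) → (∀ l → l ∈L T → l ∈L Ps)
        → (∀ i j → lab Ps i ≡ lab T j → Γ ⊩ cont Ps i ▷ ((k , p) , cont T j) ∷ Δ)
        → IsTyping Δ' → Δ' ↭ ((k , p) , ⟪ T ⟫T) ∷ Δ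
        → Γ ⊩ specsel (pol k p) Ps ▷ Δ'
  t-orch : ∀ {k f S₁ S₂ P Δ}
        → Γ ⊩ P ▷ ((k , ⁻) , S₁) ∷ ((k , ⁺) , S₂) ∷ Δ
        → f ∶ S₁ ⊣ S₂
        → Γ ⊩ orch k f P ▷ Δ

data KProc (k : ChName) (p : Pol) : Proc → Set where
  kp-send    : ∀ {e P} → KProc k p (send (pol k p) e P)
  kp-recv    : ∀ {x P} → KProc k p (recv (pol k p) x P)
  kp-throw   : ∀ {c P} → KProc k p (throw (pol k p) c P)
  kp-catch   : ∀ {k' P} → KProc k p (catch (pol k p) k' P)
  kp-select  : ∀ {l P} → KProc k p (select (pol k p) l P)
  kp-branch  : ∀ {F} → KProc k p (branch (pol k p) F)
  kp-specsel : ∀ {F} → KProc k p (specsel (pol k p) F)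

data AxRed (k : ChName) : Orch → Proc → Proc → Set where
  ax-com : ∀ {f p e P x Q v} → eval e ≡ just v
         → AxRed k (• f) (send (pol k p) e P) (recv (pol k (dual p)) x Q)
  ax-del : ∀ {f p k' q P k'' Q}
         → AxRed k (• f) (throw (pol k p) (pol k' q) P) (catch (pol k (dual p)) k'' Q)
  ax-sel : ∀ {f O p l P Qs} → SumOf f O → l ∈L O → l ∈L Qs
         → AxRed k f (select (pol k p) l P) (branch (pol k (dual p)) Qs)
  ax-spec : ∀ {f O p Ps Qs} (h : Idx O) → OplusOf f O
         → lab O h ∈L Ps → lab O h ∈L Qs
         → AxRed k f (specsel (pol k p) Ps) (branch (pol k (dual p)) Qs)

-- the potential redex reduces (parallel composition is commutative)
Reduces : ChName → Orch → Proc → Proc → Set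
Reduces k f A B = AxRed k f A B ⊎ AxRed k f B A

-- A occurs as a parallel component of P in the scope of k
-- (through | and through nested orchestrated restrictions of other names,
--  which scope extrusion allows to rearrange)
data In (k : ChName) (A : Proc) : Proc → Set where
  here  : In k A A
  parˡ  : ∀ {P Q} → In k A P → In k A (P ∥ Q)
  parʳ  : ∀ {P Q} → In k A Q → In k A (P ∥ Q)
  under : ∀ {k' g P} → k' ≢ k → In k A P → In k A (orch k' g P)

data In2 (k : ChName) (A B : Proc) : Proc → Set where
  split  : ∀ {P Q} → In k A P → In k B Q → In2 k A B (P ∥ Q)
  split' : ∀ {P Q} → In k B P → In k A Q → In2 k A B (P ∥ Q)
  parˡ   : ∀ {P Q} → In2 k A B P → In2 k A B (P ∥ Q)
  parʳ   : ∀ {P Q} → In2 k A B Q → In2 k A B (P ∥ Q)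
  under  : ∀ {k' g P} → k' ≢ k → In2 k A B P → In2 k A B (orch k' g P)

-- (νk)(k[f] | P) occurs as a subterm of R (orchestrators occur only at
-- parallel/restriction positions in user-defined and run-time processes)
data OrchIn (k : ChName) (f : Orch) (P : Proc) : Proc → Set where
  here  : OrchIn k f P (orch k f P)
  parˡ  : ∀ {Q R} → OrchIn k f P Q → OrchIn k f P (Q ∥ R)
  parʳ  : ∀ {Q R} → OrchIn k f P R → OrchIn k f P (Q ∥ R)
  under : ∀ {k' g Q} → OrchIn k f P Q → OrchIn k f P (orch k' g Q)

SyncError : Proc → Set
SyncError R =
  Σ ChName λ k → Σ Orch λ f → Σ Proc λ P → Σ Proc λ A → Σ Proc λ B →
  Σ Pol λ p → Σ Pol λ q →
  OrchIn k f P R × In2 k A B P × KProc k p A × KProc k q B × ¬ Reduces k f A B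

VacuousError : Proc → Set
VacuousError R =
  Σ ChName λ k → Σ Proc λ P → Σ Proc λ A →
  OrchIn k 𝟙 P R × In k A P × KProc k ⁻ A

Error : Proc → Set
Error R = SyncError R ⊎ VacuousError R

module Submission where

open import Defs
open import Relation.Nullary using (¬_)
open import Data.Fin using (zero)
open import Data.List using (List; _∷_; map; _++_)
open import Data.List.Membership.Propositional using (_∈_)
open import Data.List.Membership.Propositional.Properties using (∈-map⁺; ∈-++⁺ˡ; ∈-++⁺ʳ)
open import Data.List.Relation.Unary.Any using (here; there)
open import Data.List.Relation.Unary.AllPairs using (_∷_)
open import Data.List.Relation.Unary.Unique.Propositional using (Unique)
open import Data.List.Relation.Unary.Unique.Propositional.Properties using (Unique[x∷xs]⇒x∉xs)
open import Data.List.Relation.Binary.Permutation.Propositional using (_↭_; ↭-sym; ↭⇒↭ₛ)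
open import Data.List.Relation.Binary.Permutation.Propositional.Properties using (∈-resp-↭; map⁺)
open import Data.List.Relation.Binary.Permutation.Setoid.Properties using (Unique-resp-↭)
open import Data.Product using (Σ; _×_; _,_; proj₁)
open import Data.Sum using (inj₁; inj₂)
open import Data.Empty using (⊥; ⊥-elim)
open import Relation.Binary.PropositionalEquality using (_≡_; _≢_; refl; setoid)

-- Both kinds of error live inside an orchestrated restriction (νk)(k[f] | P).
-- Typing P yields k⁻ : S₁ and k⁺ : S₂ with f ∶ S₁ ⊣ S₂, and every k^p-process
-- found among the parallel components of P is typed by the unique entry for
-- k^p, whose outermost constructor matches the process prefix.  Two such
-- components cannot share a polarity, since parallel composition splits the
-- typing disjointly; so they sit at k⁻ and k⁺, and compliance of their types
-- forces one of the reduction axioms to fire.  A vacuous orchestrator k[𝟙]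
-- forces S₁ = end, which types no k⁻-process.

module _ {A B : Set} where

  unique-keys-functional : ∀ {xs : List (A × B)} {x y y'} → Unique (map proj₁ xs)
                         → (x , y) ∈ xs → (x , y') ∈ xs → y ≡ y'
  unique-keys-functional _ (here refl) (here refl) = refl
  unique-keys-functional u (here refl) (there m) = ⊥-elim (Unique[x∷xs]⇒x∉xs u (∈-map⁺ proj₁ m))
  unique-keys-functional u (there m) (here refl) = ⊥-elim (Unique[x∷xs]⇒x∉xs u (∈-map⁺ proj₁ m))
  unique-keys-functional (_ ∷ u) (there m) (there m') = unique-keys-functional u m m'

  unique-keys-++-disjoint : ∀ {xs ys : List (A × B)} {x y y'} → Unique (map proj₁ (xs ++ ys))
                          → (x , y) ∈ xs → (x , y') ∈ ys → ⊥
  unique-keys-++-disjoint {xs = _ ∷ xs} u (here refl) m' =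
    Unique[x∷xs]⇒x∉xs u (∈-map⁺ proj₁ (∈-++⁺ʳ xs m'))
  unique-keys-++-disjoint (_ ∷ u) (there m) m' = unique-keys-++-disjoint u m m'

unique-resp-↭ : ∀ {A : Set} {xs ys : List A} → xs ↭ ys → Unique xs → Unique ys
unique-resp-↭ {A} p = Unique-resp-↭ (setoid A) (↭⇒↭ₛ p)

∈-↭-++ˡ : ∀ {A : Set} {xs ys zs : List A} {x} → xs ↭ ys ++ zs → x ∈ ys → x ∈ xs
∈-↭-++ˡ p m = ∈-resp-↭ (↭-sym p) (∈-++⁺ˡ m)

∈-↭-++ʳ : ∀ {A : Set} {xs ys zs : List A} {x} → xs ↭ ys ++ zs → x ∈ zs → x ∈ xs
∈-↭-++ʳ {ys = ys} p m = ∈-resp-↭ (↭-sym p) (∈-++⁺ʳ ys m)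

∈-↭-head : ∀ {A : Set} {xs ys : List A} {x} → xs ↭ x ∷ ys → x ∈ xs
∈-↭-head p = ∈-resp-↭ (↭-sym p) (here refl)

⊩⇒IsTyping : ∀ {Γ P Δ} → Γ ⊩ P ▷ Δ → IsTyping Δ
⊩⇒IsTyping (t-nil u _) = u
⊩⇒IsTyping (t-par _ _ u _) = u
⊩⇒IsTyping (t-accept t) with ⊩⇒IsTyping t
... | _ ∷ u = u
⊩⇒IsTyping (t-request t) with ⊩⇒IsTyping t
... | _ ∷ u = u
⊩⇒IsTyping (t-recv _ u _) = u
⊩⇒IsTyping (t-send _ _ u _) = u
⊩⇒IsTyping (t-catch _ u _) = u
⊩⇒IsTyping (t-throw _ u _) = u
⊩⇒IsTyping (t-branch _ _ _ u _) = u
⊩⇒IsTyping (t-select _ _ u _) = u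
⊩⇒IsTyping (t-spec _ _ _ u _) = u
⊩⇒IsTyping (t-orch t _) with ⊩⇒IsTyping t
... | _ ∷ _ ∷ u = u

_⊆[_]_ : Typing → ChName → Typing → Set
Δ' ⊆[ k ] Δ = ∀ {p T} → ((k , p) , T) ∈ Δ' → ((k , p) , T) ∈ Δ

DisjointOn : ChName → Typing → Typing → Set
DisjointOn k Δ₁ Δ₂ = ∀ {p T U} → ((k , p) , T) ∈ Δ₁ → ((k , p) , U) ∈ Δ₂ → ⊥

∉-restricted : ∀ {k k' S₁ S₂ Δ} → k' ≢ k → (((k' , ⁻) , S₁) ∷ ((k' , ⁺) , S₂) ∷ Δ) ⊆[ k ] Δ
∉-restricted k'≢k (here refl) = ⊥-elim (k'≢k refl)
∉-restricted k'≢k (there (here refl)) = ⊥-elim (k'≢k refl)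
∉-restricted _ (there (there m)) = m

record Component (Γ : Ctx) (k : ChName) (Δ : Typing) (A : Proc) : Set where
  field
    typing  : Typing
    typed   : Γ ⊩ A ▷ typing
    closed  : Closed A
    entries : typing ⊆[ k ] Δ

record Components (Γ : Ctx) (k : ChName) (Δ : Typing) (A B : Proc) : Set where
  field
    left     : Component Γ k Δ A
    right    : Component Γ k Δ B
    disjoint : DisjointOn k (Component.typing left) (Component.typing right)

module _ {Γ : Ctx} {k : ChName} {A : Proc} where

  component-weaken : ∀ {Δ Δ'} → Δ ⊆[ k ] Δ' → Component Γ k Δ A → Component Γ k Δ' A
  component-weaken sub c = record
    { typing = typing ; typed = typed ; closed = closed ; entries = λ m → sub (entries m) }
    where open Component c

  In-component : ∀ {P Δ} → In k A P → Closed P → Γ ⊩ P ▷ Δ → Component Γ k Δ A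
  In-component here cl t = record { typing = _ ; typed = t ; closed = cl ; entries = λ m → m }
  In-component (parˡ i) (cl-par cl _) (t-par t _ _ p) =
    component-weaken (∈-↭-++ˡ p) (In-component i cl t)
  In-component (parʳ i) (cl-par _ cl) (t-par _ t _ p) =
    component-weaken (∈-↭-++ʳ p) (In-component i cl t)
  In-component (under k'≢k i) (cl-orch cl) (t-orch t _) =
    component-weaken (∉-restricted k'≢k) (In-component i cl t)

module _ {Γ : Ctx} {k : ChName} where

  components-weaken : ∀ {A B Δ Δ'} → Δ ⊆[ k ] Δ' → Components Γ k Δ A B → Components Γ k Δ' A B
  components-weaken sub cs = record
    { left = component-weaken sub left ; right = component-weaken sub right ; disjoint = disjoint }
    where open Components cs

  split-components : ∀ {A B Δ Δ₁ Δ₂} → IsTyping Δ → Δ ↭ Δ₁ ++ Δ₂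
                   → Component Γ k Δ₁ A → Component Γ k Δ₂ B → Components Γ k Δ A B
  split-components u p cA cB = record
    { left = component-weaken (∈-↭-++ˡ p) cA
    ; right = component-weaken (∈-↭-++ʳ p) cB
    ; disjoint = λ m m' → unique-keys-++-disjoint (unique-resp-↭ (map⁺ proj₁ p) u)
                           (Component.entries cA m) (Component.entries cB m') }

  components-swap : ∀ {A B Δ} → Components Γ k Δ B A → Components Γ k Δ A B
  components-swap cs = record
    { left = Components.right cs ; right = Components.left cs
    ; disjoint = λ m m' → Components.disjoint cs m' m }

  In2-components : ∀ {A B P Δ} → In2 k A B P → Closed P → Γ ⊩ P ▷ Δ → Components Γ k Δ A B
  In2-components (split i j) (cl-par cl cl') (t-par t t' u p) =
    split-components u p (In-component i cl t) (In-component j cl' t')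
  In2-components (split' i j) (cl-par cl cl') (t-par t t' u p) =
    components-swap (split-components u p (In-component i cl t) (In-component j cl' t'))
  In2-components (parˡ i) (cl-par cl _) (t-par t _ _ p) =
    components-weaken (∈-↭-++ˡ p) (In2-components i cl t)
  In2-components (parʳ i) (cl-par _ cl) (t-par _ t _ p) =
    components-weaken (∈-↭-++ʳ p) (In2-components i cl t)
  In2-components (under k'≢k i) (cl-orch cl) (t-orch t _) =
    components-weaken (∉-restricted k'≢k) (In2-components i cl t)

record Orchestrated (Γ : Ctx) (k : ChName) (f : Orch) (P : Proc) : Set where
  field
    {S₁ S₂} : SType
    {rest}  : Typing
    body       : Γ ⊩ P ▷ ((k , ⁻) , S₁) ∷ ((k , ⁺) , S₂) ∷ rest
    compliance : f ∶ S₁ ⊣ S₂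
    closed     : Closed P

OrchIn-orchestrated : ∀ {Γ k f P R Δ} → OrchIn k f P R → Closed R → Γ ⊩ R ▷ Δ
                    → Orchestrated Γ k f P
OrchIn-orchestrated here (cl-orch cl) (t-orch t c) = record { body = t ; compliance = c ; closed = cl }
OrchIn-orchestrated (parˡ o) (cl-par cl _) (t-par t _ _ _) = OrchIn-orchestrated o cl t
OrchIn-orchestrated (parʳ o) (cl-par _ cl) (t-par _ t _ _) = OrchIn-orchestrated o cl t
OrchIn-orchestrated (under o) (cl-orch cl) (t-orch t _) = OrchIn-orchestrated o cl t

-- The label inclusions are those the reduction axioms ask for; a send carries
-- a value because a closed process never sends a variable.
data PrefixOf (k : ChName) (p : Pol) : Proc → SType → Set where
  send    : ∀ {v P G S} → PrefixOf k p (send (pol k p) (val v) P) (!G G ∙ S)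
  recv    : ∀ {x P G S} → PrefixOf k p (recv (pol k p) x P) (?G G ∙ S)
  throw   : ∀ {k' q P S₁ S₂} → PrefixOf k p (throw (pol k p) (pol k' q) P) (!S S₁ q S₂)
  catch   : ∀ {k' q P S₁ S₂} → PrefixOf k p (catch (pol k p) k' P) (?S S₁ q S₂)
  select  : ∀ {T j P} → PrefixOf k p (select (pol k p) (lab T j) P) (⊕T T)
  branch  : ∀ {Qs T} → (∀ l → l ∈L T → l ∈L Qs) → PrefixOf k p (branch (pol k p) Qs) (&T T)
  specsel : ∀ {Ps T} → (∀ l → l ∈L T → l ∈L Ps) → PrefixOf k p (specsel (pol k p) Ps) ⟪ T ⟫T

KProc-prefix : ∀ {Γ k p A Δ} → KProc k p A → Closed A → Γ ⊩ A ▷ Δ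
             → Σ SType λ T → ((k , p) , T) ∈ Δ × PrefixOf k p A T
KProc-prefix kp-send (cl-send (ce-var ()) _) _
KProc-prefix kp-send (cl-send ce-val _) (t-send _ _ _ p) = _ , ∈-↭-head p , send
KProc-prefix kp-recv _ (t-recv _ _ p) = _ , ∈-↭-head p , recv
KProc-prefix kp-throw _ (t-throw _ _ p) = _ , ∈-↭-head p , throw
KProc-prefix kp-catch _ (t-catch _ _ p) = _ , ∈-↭-head p , catch
KProc-prefix kp-select _ (t-select _ _ _ p) = _ , ∈-↭-head p , select
KProc-prefix kp-branch _ (t-branch _ _ cover _ p) =
  _ , ∈-↭-head p , branch (λ { l (j , refl) → let (i , l≡ , _) = cover j in i , l≡ })
KProc-prefix kp-specsel _ (t-spec _ T⊆Ps _ _ p) = _ , ∈-↭-head p , specsel T⊆Ps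

¬PrefixOf-end : ∀ {k p A} → ¬ PrefixOf k p A end
¬PrefixOf-end ()

reduces-sym : ∀ {k f A B} → Reduces k f A B → Reduces k f B A
reduces-sym (inj₁ r) = inj₂ r
reduces-sym (inj₂ r) = inj₁ r

-- The speculative cases fire on the first label of the orchestrator, which
-- compliance places in both label sets.
compliant-prefixes-reduce : ∀ {k p f A B S S'}
                          → PrefixOf k p A S → PrefixOf k (dual p) B S' → f ∶ S ⊣ S'
                          → Reduces k f A B
compliant-prefixes-reduce {p = ⁺} recv send (c-in _) = inj₂ (ax-com refl)
compliant-prefixes-reduce {p = ⁻} recv send (c-in _) = inj₂ (ax-com refl)
compliant-prefixes-reduce send recv (c-out _) = inj₁ (ax-com refl)
compliant-prefixes-reduce {p = ⁺} catch throw (c-sin _) = inj₂ ax-del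
compliant-prefixes-reduce {p = ⁻} catch throw (c-sin _) = inj₂ ax-del
compliant-prefixes-reduce throw catch (c-sout _) = inj₁ ax-del
compliant-prefixes-reduce (select {j = j}) (branch B⊆Qs) (c-sel s _ A⊆O A⊆B _) =
  inj₁ (ax-sel s (A⊆O _ (j , refl)) (B⊆Qs _ (A⊆B _ (j , refl))))
compliant-prefixes-reduce {p = ⁺} (branch A⊆Qs) (select {j = j}) (c-bra s _ B⊆O B⊆A _) =
  inj₂ (ax-sel s (B⊆O _ (j , refl)) (A⊆Qs _ (B⊆A _ (j , refl))))
compliant-prefixes-reduce {p = ⁻} (branch A⊆Qs) (select {j = j}) (c-bra s _ B⊆O B⊆A _) =
  inj₂ (ax-sel s (B⊆O _ (j , refl)) (A⊆Qs _ (B⊆A _ (j , refl))))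
compliant-prefixes-reduce (specsel A⊆Ps) (branch B⊆Qs) (c-spec o O⊆A O⊆B _) =
  inj₁ (ax-spec zero o (A⊆Ps _ (O⊆A _ (zero , refl))) (B⊆Qs _ (O⊆B _ (zero , refl))))
compliant-prefixes-reduce {p = ⁺} (branch A⊆Qs) (specsel B⊆Ps) (c-spec' o O⊆A O⊆B _) =
  inj₂ (ax-spec zero o (B⊆Ps _ (O⊆B _ (zero , refl))) (A⊆Qs _ (O⊆A _ (zero , refl))))
compliant-prefixes-reduce {p = ⁻} (branch A⊆Qs) (specsel B⊆Ps) (c-spec' o O⊆A O⊆B _) =
  inj₂ (ax-spec zero o (B⊆Ps _ (O⊆B _ (zero , refl))) (A⊆Qs _ (O⊆A _ (zero , refl))))

end-channel-idle : ∀ {Γ k p Δ A} → IsTyping Δ → ((k , p) , end) ∈ Δ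
                 → Component Γ k Δ A → ¬ KProc k p A
end-channel-idle u m cA kA with KProc-prefix kA (Component.closed cA) (Component.typed cA)
... | T , mA , prefA with unique-keys-functional u (Component.entries cA mA) m
... | refl = ¬PrefixOf-end prefA

orchestrated-pair-reduces : ∀ {Γ k S₁ S₂ Δ f A B p q}
                          → IsTyping (((k , ⁻) , S₁) ∷ ((k , ⁺) , S₂) ∷ Δ) → f ∶ S₁ ⊣ S₂
                          → Components Γ k (((k , ⁻) , S₁) ∷ ((k , ⁺) , S₂) ∷ Δ) A B
                          → KProc k p A → KProc k q B → Reduces k f A B
orchestrated-pair-reduces {Γ} {k} {f = f} {A} {B} u c cs kA kB =
  by-polarity (KProc-prefix kA (closed left) (typed left))
              (KProc-prefix kB (closed right) (typed right))
  where
  open Components cs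
  open Component
  PrefixIn : ∀ {Δ' X} → Component Γ k Δ' X → Pol → Set
  PrefixIn {X = X} side p = Σ SType λ T → ((k , p) , T) ∈ typing side × PrefixOf k p X T
  by-polarity : ∀ {p q} → PrefixIn left p → PrefixIn right q → Reduces k f A B
  by-polarity {⁻} {⁻} (_ , mA , _) (_ , mB , _) = ⊥-elim (disjoint mA mB)
  by-polarity {⁺} {⁺} (_ , mA , _) (_ , mB , _) = ⊥-elim (disjoint mA mB)
  by-polarity {⁻} {⁺} (_ , mA , prefA) (_ , mB , prefB)
    with unique-keys-functional u (entries left mA) (here refl)
       | unique-keys-functional u (entries right mB) (there (here refl))
  ... | refl | refl = compliant-prefixes-reduce prefA prefB c
  by-polarity {⁺} {⁻} (_ , mA , prefA) (_ , mB , prefB)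
    with unique-keys-functional u (entries left mA) (there (here refl))
       | unique-keys-functional u (entries right mB) (here refl)
  ... | refl | refl = reduces-sym (compliant-prefixes-reduce prefB prefA c)

lemma1 : (Γ : Ctx) (Δ : Typing) (R : Proc)
    → Good R → Closed R → Γ ⊩ R ▷ Δ → ¬ Error R
lemma1 Γ Δ R _ cl ty (inj₁ (k , f , P , A , B , p , q , o , i2 , kA , kB , ¬red)) =
  ¬red (orchestrated-pair-reduces (⊩⇒IsTyping body) compliance
         (In2-components i2 closed body) kA kB)
  where open Orchestrated (OrchIn-orchestrated o cl ty)
lemma1 Γ Δ R _ cl ty (inj₂ (k , P , A , o , i , kA)) with OrchIn-orchestrated o cl ty
... | record { body = body ; compliance = c-end ; closed = closed } =
  end-channel-idle (⊩⇒IsTyping body) (here refl) (In-component i closed body) kA
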